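{- If $G$ is a $\gamma_{tR}$-edge-supercritical graph, then $G$ contains no two adjacent endpaths, i.e., there do not exist two distinct endpaths $w,v_1,\dots,v_n$ and $w,u_1,\dots,u_m$ starting at the same vertex $w$.
   Context: All graphs are finite and simple. For a graph $G$ with no isolated vertices, a total Roman dominating function (TRD-function) is a function $f:V(G)\to\{0,1,2\}$ such that every vertex $v$ with $f(v)=0$ is adjacent to some vertex $u$ with $f(u)=2$, and the subgraph induced by $\{w: f(w)>0\}$ has no isolated vertices. Its weight is $\sum_{v}f(v)$, and $\gamma_{tR}(G)$ is the minimum weight of a TRD-function on $G$. A graph $G$ with no isolated vertices is $\gamma_{tR}$-edge-supercritical if $E(\overline{G})\neq\emptyset$ and $\gamma_{tR}(G+e)\leq\gamma_{tR}(G)-2$ for every edge $e\in E(\overline{G})$. An endpath in $G$ is a path from a vertex $w$ with $\deg(w)\geq 3$ to a vertex of degree $1$ such that all internal vertices of the path have degree $2$; two endpaths are adjacent if they start at the same vertex $w$ (and are otherwise distinct). -}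

module Defs where

open import Data.Nat using (ℕ; zero; suc; _+_; _≤_; _<_)
open import Data.Fin using (Fin; toℕ)
open import Data.Fin.Properties using (_≟_)
open import Data.Bool using (Bool; true; false; if_then_else_; _∨_; _∧_)
open import Data.List using (List; []; _∷_; map; allFin)
open import Data.Nat.ListAction using (sum)
open import Data.List.Relation.Unary.Unique.Propositional using (Unique)
open import Data.Product using (Σ; ∃; _×_; _,_)
open import Data.Empty using (⊥)
open import Relation.Nullary using (¬_)
open import Relation.Nullary.Decidable using (⌊_⌋)
open import Relation.Binary.PropositionalEquality using (_≡_; _≢_)

AdjRel : ℕ → Set
AdjRel n = Fin n → Fin n → Bool

record Graph (n : ℕ) : Set where
  field
    adj     : AdjRel n
    symm    : ∀ u v → adj u v ≡ adj v u
    irrefl  : ∀ v → adj v v ≡ false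
open Graph public

deg : ∀ {n} → AdjRel n → Fin n → ℕ
deg {n} A v = sum (map (λ u → if A v u then 1 else 0) (allFin n))

NoIsolated : ∀ {n} → AdjRel n → Set
NoIsolated {n} A = ∀ (v : Fin n) → ∃ λ u → A v u ≡ true

NonEdge : ∀ {n} → AdjRel n → Fin n → Fin n → Set
NonEdge A x y = x ≢ y × A x y ≡ false

addEdge : ∀ {n} → AdjRel n → Fin n → Fin n → AdjRel n
addEdge A x y a b =
  A a b ∨ ((⌊ a ≟ x ⌋ ∧ ⌊ b ≟ y ⌋) ∨ (⌊ a ≟ y ⌋ ∧ ⌊ b ≟ x ⌋))

weight : ∀ {n} → (Fin n → Fin 3) → ℕ
weight {n} f = sum (map (λ v → toℕ (f v)) (allFin n))

IsTRDF : ∀ {n} → AdjRel n → (Fin n → Fin 3) → Set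
IsTRDF {n} A f =
  (∀ (v : Fin n) → toℕ (f v) ≡ 0 → ∃ λ u → A v u ≡ true × toℕ (f u) ≡ 2)
  × (∀ (v : Fin n) → 0 < toℕ (f v) → ∃ λ u → A v u ≡ true × 0 < toℕ (f u))

IsγtR : ∀ {n} → AdjRel n → ℕ → Set
IsγtR A k =
  (∃ λ f → IsTRDF A f × weight f ≡ k)
  × (∀ f → IsTRDF A f → k ≤ weight f)

EdgeSupercritical : ∀ {n} → Graph n → Set
EdgeSupercritical G =
  NoIsolated (adj G)
  × (∃ λ x → ∃ λ y → NonEdge (adj G) x y)
  × (∀ x y → NonEdge (adj G) x y → ∀ k k' →
       IsγtR (adj G) k → IsγtR (addEdge (adj G) x y) k' → k' + 2 ≤ k)

EndTail : ∀ {n} → Graph n → Fin n → List (Fin n) → Set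
EndTail G prev [] = ⊥
EndTail G prev (v ∷ []) = adj G prev v ≡ true × deg (adj G) v ≡ 1
EndTail G prev (v ∷ u ∷ rest) =
  adj G prev v ≡ true × deg (adj G) v ≡ 2 × EndTail G v (u ∷ rest)

IsEndpath : ∀ {n} → Graph n → Fin n → List (Fin n) → Set
IsEndpath G w vs = 3 ≤ deg (adj G) w × EndTail G w vs × Unique (w ∷ vs)

module Submission where

-- Let the two endpaths leave w through u and v. Their inner vertices have degree 2, so distinct
-- endpaths have distinct first vertices u ≠ v, and u, v are not adjacent. Adding the edge uv
-- lowers γ_tR by at most 1, contradicting supercriticality: a TRDF f of G + uv becomes one of G
-- at extra cost ≤ 1. If f(w) > 0, raise w to 2. If f(w) = 0 and f(u), f(v) > 0, raise w to 1.
-- Otherwise f(w) = 0 and one end, say u, has value 0: if f(v) = 2, move the 2 from v to w and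
-- leave 1 on v; if not, no vertex relies on the edge uv and f itself works.

open import Defs
import Algebra.Properties.CommutativeMonoid.Sum
import Algebra.Properties.CommutativeSemigroup
open import Data.Bool using (true; false; if_then_else_)
import Data.Bool.Properties as Bool
open import Data.Fin using (Fin; zero; suc; toℕ; punchOut)
open import Data.Fin.Properties
  using (_≟_; any?; all?; punchIn-punchOut; punchOut-injective; punchInᵢ≢i; toℕ≤pred[n])
open import Data.List using (List; []; _∷_; map; allFin; tabulate)
open import Data.List.Properties using (map-tabulate)
open import Data.List.Relation.Unary.All using (_∷_)
open import Data.List.Relation.Unary.AllPairs using (_∷_)
open import Data.List.Relation.Unary.Unique.Propositional using (Unique)
open import Data.Nat as ℕ using (ℕ; zero; suc; _+_; _≤_; _<_; z≤n; s≤s; z<s; _<?_)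
open import Data.Nat.Induction using (<-wellFounded)
open import Data.Nat.ListAction using (sum)
open import Data.Nat.Properties
  using ( ≤-trans; ≤-reflexive; ≤-antisym; ≤⇒≯; ≮⇒≥; >⇒≢; n≤0⇒n≡0; m≤m+n; m≤n+m
        ; +-monoʳ-≤; +-monoˡ-≤; +-cancelˡ-≤; +-cancelʳ-≤; +-cancelʳ-≡; +-identityʳ
        ; +-0-commutativeMonoid; +-commutativeSemigroup; module ≤-Reasoning)
open import Data.Product using (∃; _×_; _,_; proj₁; proj₂)
open import Data.Sum using (_⊎_; inj₁; inj₂; swap)
import Data.Vec as Vec
open import Data.Vec.Properties using (lookup∘tabulate)
open import Data.Vec.Functional using (Vector; removeAt; updateAt)
open import Data.Vec.Functional.Properties using (updateAt-updates; updateAt-minimal)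
open import Function using (_∘_)
open import Induction.WellFounded using (Acc; acc)
open import Relation.Binary.PropositionalEquality
open import Relation.Nullary using (¬_; Dec; yes; no; contradiction)
open import Relation.Nullary.Decidable using (map′; _×-dec_; _→-dec_)

open Algebra.Properties.CommutativeMonoid.Sum +-0-commutativeMonoid
  using (sum-remove; sum-cong-≗) renaming (sum to ∑)
open Algebra.Properties.CommutativeSemigroup +-commutativeSemigroup
  using (x∙yz≈xz∙y; xy∙z≈xz∙y; xy∙z≈zy∙x)

sum-tabulate : ∀ {n} (h : Vector ℕ n) → sum (tabulate h) ≡ ∑ h
sum-tabulate {zero}  h = refl
sum-tabulate {suc n} h = cong (h zero +_) (sum-tabulate (h ∘ suc))

sum-map-allFin : ∀ {n} (h : Vector ℕ n) → sum (map h (allFin n)) ≡ ∑ h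
sum-map-allFin {n} h = trans (cong sum (map-tabulate {n = n} (λ i → i) h)) (sum-tabulate h)

module _ {n} (h : Vector ℕ (suc n)) where

  ∑-removeAt : ∀ i → h i + ∑ (removeAt h i) ≡ ∑ h
  ∑-removeAt i = sym (sum-remove {i = i} h)

  removeAt-punchOut : ∀ {i j} (i≢j : i ≢ j) → removeAt h i (punchOut i≢j) ≡ h j
  removeAt-punchOut i≢j = cong h (punchIn-punchOut i≢j)

∑-≥-one : ∀ {n} (h : Vector ℕ n) i → h i ≤ ∑ h
∑-≥-one {suc n} h i = ≤-trans (m≤m+n (h i) _) (≤-reflexive (∑-removeAt h i))

∑-≥-two : ∀ {n} (h : Vector ℕ n) {i j} → i ≢ j → h i + h j ≤ ∑ h
∑-≥-two {suc n} h {i} {j} i≢j = begin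
  h i + h j                          ≡⟨ cong (h i +_) (removeAt-punchOut h i≢j) ⟨
  h i + removeAt h i (punchOut i≢j)  ≤⟨ +-monoʳ-≤ (h i) (∑-≥-one (removeAt h i) _) ⟩
  h i + ∑ (removeAt h i)             ≡⟨ ∑-removeAt h i ⟩
  ∑ h                                ∎
  where open ≤-Reasoning

∑-≥-three : ∀ {n} (h : Vector ℕ n) {i j k} → i ≢ j → i ≢ k → j ≢ k → h i + (h j + h k) ≤ ∑ h
∑-≥-three {suc n} h {i} {j} {k} i≢j i≢k j≢k = begin
  h i + (h j + h k)
    ≡⟨ cong₂ (λ a b → h i + (a + b)) (removeAt-punchOut h i≢j) (removeAt-punchOut h i≢k) ⟨
  h i + (h′ (punchOut i≢j) + h′ (punchOut i≢k))
    ≤⟨ +-monoʳ-≤ (h i) (∑-≥-two h′ (j≢k ∘ punchOut-injective i≢j i≢k)) ⟩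
  h i + ∑ h′
    ≡⟨ ∑-removeAt h i ⟩
  ∑ h ∎
  where
  open ≤-Reasoning
  h′ = removeAt h i

adjacency : ∀ {n} → AdjRel n → Fin n → Vector ℕ n
adjacency A x y = if A x y then 1 else 0

deg≡∑ : ∀ {n} (A : AdjRel n) x → deg A x ≡ ∑ (adjacency A x)
deg≡∑ A x = sum-map-allFin (adjacency A x)

adjacency-edge : ∀ {n} (A : AdjRel n) {x y} → A x y ≡ true → adjacency A x y ≡ 1
adjacency-edge A x~y rewrite x~y = refl

module _ {n} (A : AdjRel n) {x : Fin n} where

  deg-≥-two : ∀ {a b} → a ≢ b → A x a ≡ true → A x b ≡ true → 2 ≤ deg A x
  deg-≥-two a≢b x~a x~b =
    subst₂ _≤_ (cong₂ _+_ (adjacency-edge A x~a) (adjacency-edge A x~b)) (sym (deg≡∑ A x))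
      (∑-≥-two (adjacency A x) a≢b)

  deg-≥-three : ∀ {a b c} → a ≢ b → a ≢ c → b ≢ c →
                A x a ≡ true → A x b ≡ true → A x c ≡ true → 3 ≤ deg A x
  deg-≥-three a≢b a≢c b≢c x~a x~b x~c =
    subst₂ _≤_
      (cong₂ _+_ (adjacency-edge A x~a) (cong₂ _+_ (adjacency-edge A x~b) (adjacency-edge A x~c)))
      (sym (deg≡∑ A x))
      (∑-≥-three (adjacency A x) a≢b a≢c b≢c)

  deg≤1-neighbour-unique : deg A x ≤ 1 → ∀ {a b} → A x a ≡ true → A x b ≡ true → a ≡ b
  deg≤1-neighbour-unique d {a} {b} x~a x~b with a ≟ b
  ... | yes a≡b = a≡b
  ... | no a≢b  = contradiction (deg-≥-two a≢b x~a x~b) (≤⇒≯ d)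

  deg≤2-third-neighbour : deg A x ≤ 2 → ∀ {a b c} → a ≢ b → a ≢ c →
                          A x a ≡ true → A x b ≡ true → A x c ≡ true → b ≡ c
  deg≤2-third-neighbour d {b = b} {c} a≢b a≢c x~a x~b x~c with b ≟ c
  ... | yes b≡c = b≡c
  ... | no b≢c  = contradiction (deg-≥-three a≢b a≢c b≢c x~a x~b x~c) (≤⇒≯ d)

module _ {n} (G : Graph n) where

  adj-sym : ∀ {a b} → adj G a b ≡ true → adj G b a ≡ true
  adj-sym {a} {b} = trans (symm G b a)

  endTail-adj : ∀ {p x r} → EndTail G p (x ∷ r) → adj G p x ≡ true
  endTail-adj {r = []}    = proj₁
  endTail-adj {r = _ ∷ _} = proj₁

  endTail-deg≤2 : ∀ {p x r} → EndTail G p (x ∷ r) → deg (adj G) x ≤ 2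
  endTail-deg≤2 {r = []}    (_ , d)     = ≤-trans (≤-reflexive d) (s≤s z≤n)
  endTail-deg≤2 {r = _ ∷ _} (_ , d , _) = ≤-reflexive d

  endTail-unique : ∀ {p x r₁ r₂} → EndTail G p (x ∷ r₁) → EndTail G p (x ∷ r₂) →
                   Unique (p ∷ x ∷ r₁) → Unique (p ∷ x ∷ r₂) → r₁ ≡ r₂
  endTail-unique {r₁ = []}    {[]}    _ _ _ _ = refl
  endTail-unique {r₁ = []}    {_ ∷ _} (_ , d₁) (_ , d₂ , _) _ _ = contradiction (trans (sym d₁) d₂) λ ()
  endTail-unique {r₁ = _ ∷ _} {[]}    (_ , d₂ , _) (_ , d₁) _ _ = contradiction (trans (sym d₁) d₂) λ ()
  endTail-unique {r₁ = y₁ ∷ _} {_ ∷ _} (p~x , d , t₁) (_ , _ , t₂)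
                 ((_ ∷ p≢y₁ ∷ _) ∷ U₁) ((_ ∷ p≢y₂ ∷ _) ∷ U₂)
    with deg≤2-third-neighbour (adj G) (≤-reflexive d) p≢y₁ p≢y₂
           (adj-sym p~x) (endTail-adj t₁) (endTail-adj t₂)
  ... | refl = cong (y₁ ∷_) (endTail-unique t₁ t₂ U₁ U₂)

  endTail-head-nonadjacent : ∀ {w u r v} → EndTail G w (u ∷ r) → Unique (w ∷ u ∷ r) →
                             adj G w v ≡ true → w ≢ v → u ≢ v → adj G u v ≡ false
  endTail-head-nonadjacent {w} {u} {r} {v} t U w~v w≢v u≢v = Bool.¬-not (nonadjacent r t U)
    where
    nonadjacent : ∀ r → EndTail G w (u ∷ r) → Unique (w ∷ u ∷ r) → ¬ adj G u v ≡ true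
    nonadjacent [] (w~u , d) _ u~v =
      w≢v (deg≤1-neighbour-unique (adj G) (≤-reflexive d) (adj-sym w~u) u~v)
    nonadjacent (y ∷ r) (w~u , d , t) ((_ ∷ w≢y ∷ _) ∷ _) u~v
      with deg≤2-third-neighbour (adj G) (≤-reflexive d) w≢y w≢v (adj-sym w~u) (endTail-adj t) u~v
    nonadjacent (v ∷ []) (_ , _ , (_ , d′)) ((w≢u ∷ _) ∷ _) u~v | refl =
      w≢u (sym (deg≤1-neighbour-unique (adj G) (≤-reflexive d′) (adj-sym u~v) (adj-sym w~v)))
    nonadjacent (v ∷ z ∷ r) (_ , _ , (_ , d′ , t′)) ((w≢u ∷ _ ∷ w≢z ∷ _) ∷ (_ ∷ u≢z ∷ _) ∷ _) u~v | refl =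
      w≢z (sym (deg≤2-third-neighbour (adj G) (≤-reflexive d′) u≢z (w≢u ∘ sym)
                  (adj-sym u~v) (endTail-adj t′) (adj-sym w~v)))

_[_]≔_ : ∀ {n} {X : Set} → Vector X n → Fin n → X → Vector X n
f [ a ]≔ c = updateAt f a (λ _ → c)

module _ {n} {X : Set} (f : Vector X n) (a : Fin n) (c : X) where

  []≔-updates : (f [ a ]≔ c) a ≡ c
  []≔-updates = updateAt-updates a f

  []≔-minimal : ∀ {x} → x ≢ a → (f [ a ]≔ c) x ≡ f x
  []≔-minimal {x} = updateAt-minimal x a f

weight≡∑ : ∀ {n} (f : Fin n → Fin 3) → weight f ≡ ∑ (toℕ ∘ f)
weight≡∑ f = sum-map-allFin (toℕ ∘ f)

weight-resp : ∀ {n} {f g : Fin n → Fin 3} → f ≗ g → weight f ≡ weight g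
weight-resp {f = f} {g} f≗g =
  trans (weight≡∑ f) (trans (sum-cong-≗ (cong toℕ ∘ f≗g)) (sym (weight≡∑ g)))

weight-[]≔ : ∀ {n} (f : Fin n → Fin 3) a c → weight (f [ a ]≔ c) + toℕ (f a) ≡ weight f + toℕ c
weight-[]≔ {suc n} f a c = begin
  weight g + toℕ (f a)                               ≡⟨ cong (_+ toℕ (f a)) (weight≡∑ g) ⟩
  ∑ (toℕ ∘ g) + toℕ (f a)                            ≡⟨ cong (_+ toℕ (f a)) (∑-removeAt (toℕ ∘ g) a) ⟨
  (toℕ (g a) + ∑ (removeAt (toℕ ∘ g) a)) + toℕ (f a) ≡⟨ cong₂ (λ p q → (p + q) + toℕ (f a)) ga≡c rest ⟩
  (toℕ c + ∑ (removeAt (toℕ ∘ f) a)) + toℕ (f a)     ≡⟨ xy∙z≈zy∙x (toℕ c) _ (toℕ (f a)) ⟩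
  (toℕ (f a) + ∑ (removeAt (toℕ ∘ f) a)) + toℕ c     ≡⟨ cong (_+ toℕ c) (∑-removeAt (toℕ ∘ f) a) ⟩
  ∑ (toℕ ∘ f) + toℕ c                                ≡⟨ cong (_+ toℕ c) (weight≡∑ f) ⟨
  weight f + toℕ c                                   ∎
  where
  open ≡-Reasoning
  g = f [ a ]≔ c
  ga≡c : toℕ (g a) ≡ toℕ c
  ga≡c = cong toℕ ([]≔-updates f a c)
  rest : ∑ (removeAt (toℕ ∘ g) a) ≡ ∑ (removeAt (toℕ ∘ f) a)
  rest = sum-cong-≗ (λ i → cong toℕ ([]≔-minimal f a c (punchInᵢ≢i a i)))

weight-[]≔-≤ : ∀ {n} (f : Fin n → Fin 3) a c {k} → toℕ c ≤ toℕ (f a) + k →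
               weight (f [ a ]≔ c) ≤ weight f + k
weight-[]≔-≤ f a c {k} c≤fa+k = +-cancelʳ-≤ (toℕ (f a)) _ _ (begin
  weight (f [ a ]≔ c) + toℕ (f a) ≡⟨ weight-[]≔ f a c ⟩
  weight f + toℕ c                ≤⟨ +-monoʳ-≤ (weight f) c≤fa+k ⟩
  weight f + (toℕ (f a) + k)      ≡⟨ x∙yz≈xz∙y (weight f) _ k ⟩
  (weight f + k) + toℕ (f a)      ∎)
  where open ≤-Reasoning

module _ {n} (A : AdjRel n) (f : Fin n → Fin 3) where

  Dominated Supported TRDFAt : Fin n → Set
  Dominated x = toℕ (f x) ≡ 0 → ∃ λ z → A x z ≡ true × toℕ (f z) ≡ 2
  Supported x = 0 < toℕ (f x) → ∃ λ z → A x z ≡ true × 0 < toℕ (f z)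
  TRDFAt x = Dominated x × Supported x

  TRDFAt-by-two : ∀ {x z} → A x z ≡ true → toℕ (f z) ≡ 2 → TRDFAt x
  TRDFAt-by-two x~z fz≡2 = (λ _ → _ , x~z , fz≡2) , (λ _ → _ , x~z , subst (0 <_) (sym fz≡2) z<s)

  TRDFAt-by-positive : ∀ {x z} → A x z ≡ true → 0 < toℕ (f x) → 0 < toℕ (f z) → TRDFAt x
  TRDFAt-by-positive x~z fx>0 fz>0 = (λ fx≡0 → contradiction fx≡0 (>⇒≢ fx>0)) , (λ _ → _ , x~z , fz>0)

  TRDF⇒TRDFAt : IsTRDF A f → ∀ x → TRDFAt x
  TRDF⇒TRDFAt (dom , sup) x = dom x , sup x

  TRDFAt⇒TRDF : (∀ x → TRDFAt x) → IsTRDF A f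
  TRDFAt⇒TRDF h = (λ x → proj₁ (h x)) , (λ x → proj₂ (h x))

positive-≢-zero : ∀ {n} (f : Fin n → Fin 3) {x y} → 0 < toℕ (f x) → toℕ (f y) ≡ 0 → x ≢ y
positive-≢-zero f fx>0 fy≡0 refl = contradiction fy≡0 (>⇒≢ fx>0)

TRDFAt-restrict : ∀ {n} {A′ A : AdjRel n} {f} {x} →
  (∀ {z} → A′ x z ≡ true → toℕ (f x) ≡ 0 → toℕ (f z) ≡ 2 → A x z ≡ true) →
  (∀ {z} → A′ x z ≡ true → 0 < toℕ (f x) → 0 < toℕ (f z) → A x z ≡ true) →
  TRDFAt A′ f x → TRDFAt A f x
TRDFAt-restrict dom sup (d , s) =
  (λ fx≡0 → let z , x~z , fz≡2 = d fx≡0 in z , dom x~z fx≡0 fz≡2 , fz≡2) ,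
  (λ fx>0 → let z , x~z , fz>0 = s fx>0 in z , sup x~z fx>0 fz>0 , fz>0)

raise-TRDF : ∀ {n} {A : AdjRel n} {f a c} → IsTRDF A f → toℕ (f a) ≤ toℕ c →
             (∃ λ z → A a z ≡ true × 0 < toℕ (f z)) → IsTRDF A (f [ a ]≔ c)
raise-TRDF {A = A} {f} {a} {c} (dom , sup) fa≤c (z₀ , a~z₀ , fz₀>0) =
  TRDFAt⇒TRDF A g (λ x → dom′ x , sup′ x)
  where
  g = f [ a ]≔ c
  unchanged : ∀ {x} → x ≢ a → toℕ (g x) ≡ toℕ (f x)
  unchanged x≢a = cong toℕ ([]≔-minimal f a c x≢a)
  f≤g : ∀ x → toℕ (f x) ≤ toℕ (g x)
  f≤g x with x ≟ a
  ... | yes refl = subst (toℕ (f a) ≤_) (cong toℕ (sym ([]≔-updates f a c))) fa≤c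
  ... | no x≢a   = ≤-reflexive (sym (unchanged x≢a))
  two-kept : ∀ {x} → toℕ (f x) ≡ 2 → toℕ (g x) ≡ 2
  two-kept {x} fx≡2 = ≤-antisym (toℕ≤pred[n] (g x)) (subst (_≤ toℕ (g x)) fx≡2 (f≤g x))
  positive-kept : ∀ {x} → 0 < toℕ (f x) → 0 < toℕ (g x)
  positive-kept {x} fx>0 = ≤-trans fx>0 (f≤g x)
  dom′ : ∀ x → Dominated A g x
  dom′ x gx≡0 =
    let z , x~z , fz≡2 = dom x (n≤0⇒n≡0 (subst (toℕ (f x) ≤_) gx≡0 (f≤g x)))
    in z , x~z , two-kept fz≡2
  sup′ : ∀ x → Supported A g x
  sup′ x gx>0 with x ≟ a
  ... | yes refl = z₀ , a~z₀ , positive-kept fz₀>0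
  ... | no x≢a   =
    let z , x~z , fz>0 = sup x (subst (0 <_) (unchanged x≢a) gx>0) in z , x~z , positive-kept fz>0

lower-TRDF : ∀ {n} (G : Graph n) {f a} → IsTRDF (adj G) f → toℕ (f a) ≡ 2 →
             (∀ {z} → adj G a z ≡ true → 0 < toℕ (f z)) → IsTRDF (adj G) (f [ a ]≔ suc zero)
lower-TRDF G {f} {a} (dom , sup) fa≡2 a-nbrs-positive = TRDFAt⇒TRDF (adj G) g (λ x → dom′ x , sup′ x)
  where
  g = f [ a ]≔ suc zero
  ga≡1 : toℕ (g a) ≡ 1
  ga≡1 = cong toℕ ([]≔-updates f a (suc zero))
  unchanged : ∀ {x} → x ≢ a → toℕ (g x) ≡ toℕ (f x)
  unchanged x≢a = cong toℕ ([]≔-minimal f a (suc zero) x≢a)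
  positive-kept : ∀ {x} → 0 < toℕ (f x) → 0 < toℕ (g x)
  positive-kept {x} fx>0 with x ≟ a
  ... | yes refl = subst (0 <_) (sym ga≡1) z<s
  ... | no x≢a   = subst (0 <_) (sym (unchanged x≢a)) fx>0
  positive-back : ∀ {x} → 0 < toℕ (g x) → 0 < toℕ (f x)
  positive-back {x} gx>0 with x ≟ a
  ... | yes refl = subst (0 <_) (sym fa≡2) z<s
  ... | no x≢a   = subst (0 <_) (unchanged x≢a) gx>0
  dom′ : ∀ x → Dominated (adj G) g x
  dom′ x gx≡0 with x ≟ a
  ... | yes refl = contradiction (trans (sym ga≡1) gx≡0) λ ()
  ... | no x≢a with dom x (trans (sym (unchanged x≢a)) gx≡0)
  ...   | z , x~z , fz≡2 with z ≟ a
  ...     | yes refl = contradiction (trans (sym (unchanged x≢a)) gx≡0)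
                                     (>⇒≢ (a-nbrs-positive (adj-sym G x~z)))
  ...     | no z≢a   = z , x~z , trans (unchanged z≢a) fz≡2
  sup′ : ∀ x → Supported (adj G) g x
  sup′ x gx>0 = let z , x~z , fz>0 = sup x (positive-back gx>0) in z , x~z , positive-kept fz>0

_⊆_+⟨_─_⟩ : ∀ {n} → AdjRel n → AdjRel n → Fin n → Fin n → Set
A′ ⊆ A +⟨ u ─ v ⟩ = ∀ {a b} → A′ a b ≡ true → A a b ≡ true ⊎ (a ≡ u × b ≡ v) ⊎ (a ≡ v × b ≡ u)

addEdge-⊆ : ∀ {n} (A : AdjRel n) u v → addEdge A u v ⊆ A +⟨ u ─ v ⟩
addEdge-⊆ A u v {a} {b} e with A a b | a ≟ u | b ≟ v | a ≟ v | b ≟ u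
... | true  | _       | _       | _       | _       = inj₁ refl
... | false | yes a≡u | yes b≡v | _       | _       = inj₂ (inj₁ (a≡u , b≡v))
... | false | _       | _       | yes a≡v | yes b≡u = inj₂ (inj₂ (a≡v , b≡u))
... | false | no _    | _       | no _    | _       = contradiction e λ ()
... | false | yes _   | no _    | no _    | _       = contradiction e λ ()
... | false | no _    | _       | yes _   | no _    = contradiction e λ ()
... | false | yes _   | no _    | yes _   | no _    = contradiction e λ ()

addEdge-⊇ : ∀ {n} (A : AdjRel n) u v {a b} → A a b ≡ true → addEdge A u v a b ≡ true
addEdge-⊇ A u v a~b rewrite a~b = refl

addEdge-NoIsolated : ∀ {n} (A : AdjRel n) u v → NoIsolated A → NoIsolated (addEdge A u v)
addEdge-NoIsolated A u v no-isolated x = let y , x~y = no-isolated x in y , addEdge-⊇ A u v x~y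

module _ {n} {A′ A : AdjRel n} {u v : Fin n} (A′⊆A+uv : A′ ⊆ A +⟨ u ─ v ⟩) where

  ⊆+-swap : A′ ⊆ A +⟨ v ─ u ⟩
  ⊆+-swap e with A′⊆A+uv e
  ... | inj₁ a~b         = inj₁ a~b
  ... | inj₂ (inj₁ ends) = inj₂ (inj₂ ends)
  ... | inj₂ (inj₂ ends) = inj₂ (inj₁ ends)

  ⊆+-away : ∀ {x z} → x ≢ u → x ≢ v → A′ x z ≡ true → A x z ≡ true
  ⊆+-away x≢u x≢v e with A′⊆A+uv e
  ... | inj₁ x~z              = x~z
  ... | inj₂ (inj₁ (x≡u , _)) = contradiction x≡u x≢u
  ... | inj₂ (inj₂ (x≡v , _)) = contradiction x≡v x≢v

  ⊆+-at-end : u ≢ v → ∀ {z} → A′ u z ≡ true → A u z ≡ true ⊎ z ≡ v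
  ⊆+-at-end u≢v e with A′⊆A+uv e
  ... | inj₁ u~z              = inj₁ u~z
  ... | inj₂ (inj₁ (_ , z≡v)) = inj₂ z≡v
  ... | inj₂ (inj₂ (u≡v , _)) = contradiction u≡v u≢v

  delete-edge-TRDF : ∀ {f} → IsTRDF A′ f → TRDFAt A f u → TRDFAt A f v → IsTRDF A f
  delete-edge-TRDF {f} tf at-u at-v = TRDFAt⇒TRDF A f at
    where
    at : ∀ x → TRDFAt A f x
    at x with x ≟ u | x ≟ v
    ... | yes refl | _        = at-u
    ... | no _     | yes refl = at-v
    ... | no x≢u   | no x≢v   =
      TRDFAt-restrict {A′ = A′} {A} (λ e _ _ → ⊆+-away x≢u x≢v e) (λ e _ _ → ⊆+-away x≢u x≢v e)
        (TRDF⇒TRDFAt A′ f tf x)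

  TRDFAt-unused-edge : u ≢ v → ∀ {f} → toℕ (f v) ≢ 2 → (0 < toℕ (f u) → toℕ (f v) ≡ 0) →
                       TRDFAt A′ f u → TRDFAt A f u
  TRDFAt-unused-edge u≢v {f} fv≢2 fu>0⇒fv≡0 = TRDFAt-restrict {A′ = A′} {A} dom sup
    where
    dom : ∀ {z} → A′ u z ≡ true → toℕ (f u) ≡ 0 → toℕ (f z) ≡ 2 → A u z ≡ true
    dom e _ fz≡2 with ⊆+-at-end u≢v e
    ... | inj₁ u~z = u~z
    ... | inj₂ refl = contradiction fz≡2 fv≢2
    sup : ∀ {z} → A′ u z ≡ true → 0 < toℕ (f u) → 0 < toℕ (f z) → A u z ≡ true
    sup e fu>0 fz>0 with ⊆+-at-end u≢v e
    ... | inj₁ u~z = u~z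
    ... | inj₂ refl = contradiction (fu>0⇒fv≡0 fu>0) (>⇒≢ fz>0)

TRDF-within+1 : ∀ {n} → AdjRel n → (Fin n → Fin 3) → Set
TRDF-within+1 A f = ∃ λ g → IsTRDF A g × weight g ≤ weight f + 1

module EdgeBetweenNeighbours {n} (G : Graph n) {A′ : AdjRel n} {w u v : Fin n}
  (A′⊆G+uv : A′ ⊆ adj G +⟨ u ─ v ⟩) (G⊆A′ : ∀ {a b} → adj G a b ≡ true → A′ a b ≡ true)
  (u≢v : u ≢ v) (w~u : adj G w u ≡ true) (w~v : adj G w v ≡ true) where

  A = adj G

  w-positive : ∀ {f} → IsTRDF A′ f → 0 < toℕ (f w) → TRDF-within+1 A f
  w-positive {f} tf fw>0 =
    h , delete-edge-TRDF A′⊆G+uv h-A′ (by-w w~u) (by-w w~v) , weight-[]≔-≤ f w 2F (+-monoˡ-≤ 1 fw>0)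
    where
    2F : Fin 3
    2F = suc (suc zero)
    h = f [ w ]≔ 2F
    h-A′ : IsTRDF A′ h
    h-A′ = raise-TRDF tf (toℕ≤pred[n] (f w)) (proj₂ tf w fw>0)
    by-w : ∀ {x} → A w x ≡ true → TRDFAt A h x
    by-w w~x = TRDFAt-by-two A h (adj-sym G w~x) (cong toℕ ([]≔-updates f w 2F))

  ends-positive : ∀ {f} → IsTRDF A′ f → toℕ (f w) ≡ 0 → 0 < toℕ (f u) → 0 < toℕ (f v) →
                  TRDF-within+1 A f
  ends-positive {f} tf fw≡0 fu>0 fv>0 =
    h , delete-edge-TRDF A′⊆G+uv h-A′ (by-w w~u fu>0) (by-w w~v fv>0) , weight-[]≔-≤ f w 1F (m≤n+m 1 _)
    where
    1F : Fin 3
    1F = suc zero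
    h = f [ w ]≔ 1F
    h-A′ : IsTRDF A′ h
    h-A′ = raise-TRDF tf (subst (_≤ 1) (sym fw≡0) z≤n) (u , G⊆A′ w~u , fu>0)
    by-w : ∀ {x} → A w x ≡ true → 0 < toℕ (f x) → TRDFAt A h x
    by-w {x} w~x fx>0 = TRDFAt-by-positive A h (adj-sym G w~x)
      (subst (0 <_) (cong toℕ (sym ([]≔-minimal f w 1F x≢w))) fx>0)
      (subst (0 <_) (cong toℕ (sym ([]≔-updates f w 1F))) z<s)
      where x≢w = positive-≢-zero f fx>0 fw≡0

  edge-unused : ∀ {f} → IsTRDF A′ f → toℕ (f u) ≢ 2 → toℕ (f v) ≢ 2 →
                toℕ (f u) ≡ 0 ⊎ toℕ (f v) ≡ 0 → TRDF-within+1 A f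
  edge-unused {f} tf fu≢2 fv≢2 one-end-zero =
    f ,
    delete-edge-TRDF A′⊆G+uv tf
      (TRDFAt-unused-edge A′⊆G+uv u≢v fv≢2 (other-zero one-end-zero) (TRDF⇒TRDFAt A′ f tf u))
      (TRDFAt-unused-edge (⊆+-swap A′⊆G+uv) (u≢v ∘ sym) fu≢2 (other-zero (swap one-end-zero))
        (TRDF⇒TRDFAt A′ f tf v)) ,
    m≤m+n _ 1
    where
    other-zero : ∀ {a b} → a ≡ 0 ⊎ b ≡ 0 → 0 < a → b ≡ 0
    other-zero (inj₁ a≡0) a>0 = contradiction a≡0 (>⇒≢ a>0)
    other-zero (inj₂ b≡0) _   = b≡0

  dominating-end : deg A v ≤ 2 → ∀ {f} → IsTRDF A′ f →
                   toℕ (f w) ≡ 0 → toℕ (f u) ≡ 0 → toℕ (f v) ≡ 2 → TRDF-within+1 A f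
  dominating-end deg-v≤2 {f} tf fw≡0 fu≡0 fv≡2 = g , lower-TRDF G h-A hv≡2 v-nbrs-positive , weight-g
    where
    1F 2F : Fin 3
    1F = suc zero
    2F = suc (suc zero)
    h = f [ w ]≔ 2F
    g = h [ v ]≔ 1F
    fv>0 : 0 < toℕ (f v)
    fv>0 = subst (0 <_) (sym fv≡2) z<s
    v≢w = positive-≢-zero f fv>0 fw≡0
    hw≡2 : toℕ (h w) ≡ 2
    hw≡2 = cong toℕ ([]≔-updates f w 2F)
    hw>0 : 0 < toℕ (h w)
    hw>0 = subst (0 <_) (sym hw≡2) z<s
    hv≡2 : toℕ (h v) ≡ 2
    hv≡2 = trans (cong toℕ ([]≔-minimal f w 2F v≢w)) fv≡2
    h-A : IsTRDF A h
    h-A = delete-edge-TRDF A′⊆G+uv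
      (raise-TRDF tf (toℕ≤pred[n] (f w)) (v , G⊆A′ w~v , fv>0))
      (TRDFAt-by-two A h (adj-sym G w~u) hw≡2)
      (TRDFAt-by-positive A h (adj-sym G w~v) (subst (0 <_) (sym hv≡2) z<s) hw>0)
    -- v has degree ≤ 2: its neighbours are w and the vertex supporting v under f, which is neither u nor w.
    v-nbrs-positive : ∀ {z} → A v z ≡ true → 0 < toℕ (h z)
    v-nbrs-positive {z} v~z with proj₂ tf v fv>0
    ... | z′ , v~′z′ , fz′>0 with ⊆+-at-end (⊆+-swap A′⊆G+uv) (u≢v ∘ sym) v~′z′ | z ≟ w
    ...   | inj₂ refl | _        = contradiction fu≡0 (>⇒≢ fz′>0)
    ...   | inj₁ _    | yes refl = hw>0
    ...   | inj₁ v~z′ | no z≢w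
      with deg≤2-third-neighbour A deg-v≤2 (positive-≢-zero f fz′>0 fw≡0 ∘ sym) (z≢w ∘ sym)
             (adj-sym G w~v) v~z′ v~z
    ...     | refl = subst (0 <_) (cong toℕ (sym ([]≔-minimal f w 2F z≢w))) fz′>0
    weight-h : weight h ≡ weight f + 2
    weight-h = trans (sym (+-identityʳ _)) (trans (cong (weight h +_) (sym fw≡0)) (weight-[]≔ f w 2F))
    weight-g : weight g ≤ weight f + 1
    weight-g = ≤-reflexive (+-cancelʳ-≡ 2 _ _ (begin
      weight g + 2         ≡⟨ cong (weight g +_) hv≡2 ⟨
      weight g + toℕ (h v) ≡⟨ weight-[]≔ h v 1F ⟩
      weight h + 1         ≡⟨ cong (_+ 1) weight-h ⟩
      (weight f + 2) + 1   ≡⟨ xy∙z≈xz∙y (weight f) 2 1 ⟩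
      (weight f + 1) + 2   ∎))
      where open ≡-Reasoning

TRDF-delete-edge-between-neighbours :
  ∀ {n} (G : Graph n) {A′ : AdjRel n} {w u v : Fin n} →
  A′ ⊆ adj G +⟨ u ─ v ⟩ → (∀ {a b} → adj G a b ≡ true → A′ a b ≡ true) →
  u ≢ v → adj G w u ≡ true → adj G w v ≡ true → deg (adj G) u ≤ 2 → deg (adj G) v ≤ 2 →
  ∀ {f} → IsTRDF A′ f → TRDF-within+1 (adj G) f
TRDF-delete-edge-between-neighbours G {w = w} {u} {v} A′⊆G+uv G⊆A′ u≢v w~u w~v deg-u≤2 deg-v≤2 {f} tf =
  by-values refl refl refl
  where
  module UV = EdgeBetweenNeighbours G A′⊆G+uv G⊆A′ u≢v w~u w~v
  module VU = EdgeBetweenNeighbours G (⊆+-swap A′⊆G+uv) G⊆A′ (u≢v ∘ sym) w~v w~u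
  positive : ∀ {x c} → f x ≡ suc c → 0 < toℕ (f x)
  positive e = subst (λ d → 0 < toℕ d) (sym e) z<s
  value : ∀ {x c} → f x ≡ c → toℕ (f x) ≡ toℕ c
  value = cong toℕ
  not-two : ∀ {x c} → f x ≡ c → toℕ c ≢ 2 → toℕ (f x) ≢ 2
  not-two e c≢2 = c≢2 ∘ trans (sym (value e))
  by-values : ∀ {a b c} → f w ≡ a → f u ≡ b → f v ≡ c → TRDF-within+1 (adj G) f
  by-values {suc _} fw _  _ = UV.w-positive tf (positive fw)
  by-values {zero} {suc _} {suc _} fw fu fv = UV.ends-positive tf (value fw) (positive fu) (positive fv)
  by-values {zero} {zero}         {zero}         fw fu fv =
    UV.edge-unused tf (not-two fu λ ()) (not-two fv λ ()) (inj₁ (value fu))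
  by-values {zero} {zero}         {suc zero}     fw fu fv =
    UV.edge-unused tf (not-two fu λ ()) (not-two fv λ ()) (inj₁ (value fu))
  by-values {zero} {suc zero}     {zero}         fw fu fv =
    UV.edge-unused tf (not-two fu λ ()) (not-two fv λ ()) (inj₂ (value fv))
  by-values {zero} {zero}         {suc (suc zero)} fw fu fv =
    UV.dominating-end deg-v≤2 tf (value fw) (value fu) (value fv)
  by-values {zero} {suc (suc zero)} {zero}       fw fu fv =
    VU.dominating-end deg-u≤2 tf (value fw) (value fv) (value fu)

any?-Vec : ∀ {m n} {P : Vec.Vec (Fin m) n → Set} → (∀ xs → Dec (P xs)) → Dec (∃ P)
any?-Vec {n = zero}  P? = map′ (Vec.[] ,_) (λ { (Vec.[] , p) → p }) (P? Vec.[])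
any?-Vec {n = suc n} P? =
  map′ (λ (c , xs , p) → c Vec.∷ xs , p) (λ { (c Vec.∷ xs , p) → c , xs , p })
       (any? λ c → any?-Vec (λ xs → P? (c Vec.∷ xs)))

any?-Fun : ∀ {m n} {P : (Fin n → Fin m) → Set} → (∀ {f g} → f ≗ g → P f → P g) →
           (∀ f → Dec (P f)) → Dec (∃ P)
any?-Fun resp P? =
  map′ (λ (xs , p) → Vec.lookup xs , p) (λ (f , p) → Vec.tabulate f , resp (sym ∘ lookup∘tabulate f) p)
       (any?-Vec (P? ∘ Vec.lookup))

minimum-exists : ∀ {m n} {P : (Fin n → Fin m) → Set} (μ : (Fin n → Fin m) → ℕ) →
                 (∀ {f g} → f ≗ g → P f → P g) → (∀ {f g} → f ≗ g → μ f ≡ μ g) →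
                 (∀ f → Dec (P f)) → ∀ {f} → P f → ∃ λ g → P g × ∀ h → P h → μ g ≤ μ h
minimum-exists {P = P} μ P-resp μ-resp P? {f} pf = go f (<-wellFounded (μ f)) pf
  where
  go : ∀ f → Acc _<_ (μ f) → P f → ∃ λ g → P g × ∀ h → P h → μ g ≤ μ h
  go f (acc smaller) pf
    with any?-Fun (λ f≗g (pg , lt) → P-resp f≗g pg , subst (_< μ f) (μ-resp f≗g) lt)
                  (λ g → P? g ×-dec (μ g <? μ f))
  ... | yes (g , pg , μg<μf) = go g (smaller μg<μf) pg
  ... | no ∄smaller          = f , pf , λ h ph → ≮⇒≥ (λ μh<μf → ∄smaller (h , ph , μh<μf))

module _ {n} {A : AdjRel n} where

  IsTRDF-resp : ∀ {f g} → f ≗ g → IsTRDF A f → IsTRDF A g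
  IsTRDF-resp f≗g (dom , sup) =
    (λ x gx≡0 → let z , x~z , fz≡2 = dom x (trans (cong toℕ (f≗g x)) gx≡0) in
                z , x~z , trans (cong toℕ (sym (f≗g z))) fz≡2) ,
    (λ x gx>0 → let z , x~z , fz>0 = sup x (subst (0 <_) (cong toℕ (sym (f≗g x))) gx>0) in
                z , x~z , subst (0 <_) (cong toℕ (f≗g z)) fz>0)

  IsTRDF? : ∀ f → Dec (IsTRDF A f)
  IsTRDF? f =
    all? (λ x → (toℕ (f x) ℕ.≟ 0) →-dec any? (λ z → (A x z Bool.≟ true) ×-dec (toℕ (f z) ℕ.≟ 2)))
    ×-dec
    all? (λ x → (0 <? toℕ (f x)) →-dec any? (λ z → (A x z Bool.≟ true) ×-dec (0 <? toℕ (f z))))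

γtR-exists : ∀ {n} (A : AdjRel n) → NoIsolated A → ∃ (IsγtR A)
γtR-exists A no-isolated =
  let g , tg , minimal = minimum-exists weight IsTRDF-resp weight-resp IsTRDF? all-ones-TRDF
  in weight g , (g , tg , refl) , minimal
  where
  all-ones-TRDF : IsTRDF A (λ _ → suc zero)
  all-ones-TRDF = (λ _ ()) , λ x _ → let z , x~z = no-isolated x in z , x~z , z<s

γtR-addEdge-between-neighbours :
  ∀ {n} (G : Graph n) {w u v : Fin n} → u ≢ v → adj G w u ≡ true → adj G w v ≡ true →
  deg (adj G) u ≤ 2 → deg (adj G) v ≤ 2 →
  ∀ {k k′} → IsγtR (adj G) k → IsγtR (addEdge (adj G) u v) k′ → k ≤ k′ + 1
γtR-addEdge-between-neighbours G {u = u} {v} u≢v w~u w~v deg-u≤2 deg-v≤2 (_ , k-min) ((f , tf , refl) , _) =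
  let g , tg , g≤f+1 = TRDF-delete-edge-between-neighbours G
                         (addEdge-⊆ (adj G) u v) (addEdge-⊇ (adj G) u v) u≢v w~u w~v deg-u≤2 deg-v≤2 tf
  in ≤-trans (k-min g tg) g≤f+1

proposition4p5 : ∀ {n : ℕ} (G : Graph n) → EdgeSupercritical G →
    ¬ (∃ λ (w : Fin n) → ∃ λ (vs : List (Fin n)) → ∃ λ (us : List (Fin n)) →
         IsEndpath G w vs × IsEndpath G w us × vs ≢ us)
proposition4p5 G _ (_ , []    , _  , (_ , () , _) , _)
proposition4p5 G _ (_ , _ ∷ _ , [] , _ , (_ , () , _) , _)
proposition4p5 G (no-isolated , _ , supercritical)
               (w , u ∷ _ , v ∷ _ , (_ , tu , Uu) , (_ , tv , Uv@((w≢v ∷ _) ∷ _)) , vs≢us) =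
  let k  , γ  = γtR-exists (adj G) no-isolated
      k′ , γ′ = γtR-exists (addEdge (adj G) u v) (addEdge-NoIsolated (adj G) u v no-isolated)
      k′+2≤k′+1 = ≤-trans (supercritical u v (u≢v , u≁v) k k′ γ γ′)
                          (γtR-addEdge-between-neighbours G u≢v (endTail-adj G tu) (endTail-adj G tv)
                             (endTail-deg≤2 G tu) (endTail-deg≤2 G tv) γ γ′)
  in contradiction (+-cancelˡ-≤ k′ 2 1 k′+2≤k′+1) λ { (s≤s ()) }
  where
  u≢v : u ≢ v
  u≢v refl = vs≢us (cong (u ∷_) (endTail-unique G tu tv Uu Uv))
  u≁v : adj G u v ≡ false
  u≁v = endTail-head-nonadjacent G tu Uu (endTail-adj G tv) w≢v u≢v
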